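{- Consider an MDSP instance with $m$ drones. Let $S_1,\dots,S_m$ be pairwise disjoint subsets of $\mathcal{N}$, each compatible and critical, such that $U=\bigcup_{i=1}^m S_i$ consists of $\sum_i|S_i|$ deliveries of largest density (i.e., $d_u\ge d_v$ for all $u\in U$, $v\in\mathcal{N}\setminus U$). Then $\sum_{i=1}^m\mathcal{P}(S_i)\ge f(m)$.
   Context: An MDSP instance consists of deliveries $\mathcal{N}=\{1,\dots,n\}$ and $m$ drones, each with battery budget $B>0$. Each delivery $j$ has a closed time interval $I_j=[t_j^L,t_j^R]$, a cost $c_j>0$ and a profit $p_j\ge0$; its density is $d_j=p_j/c_j$. Deliveries $j\ne k$ are compatible if $I_j\cap I_k=\emptyset$. A set is compatible if its elements are pairwise compatible and feasible if also $\mathcal{W}(S)=\sum_{j\in S}c_j\le B$; $\mathcal{P}(S)=\sum_{j\in S}p_j$. $f(m)$ is the maximum of $\sum_{i=1}^m\mathcal{P}(T_i)$ over pairwise disjoint feasible sets $T_1,\dots,T_m$. A set $S=\{k_1,\dots,k_l\}$ listed with $d_{k_1}\ge\dots\ge d_{k_l}$ is critical if $\mathcal{W}(S)>B$ and $\mathcal{W}(S\setminus\{k_l\})\le B$.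
   Formalization: The battery budget B, the interval endpoints $t_j^L$ and $t_j^R$, the costs $c_j$ and the profits $p_j$ are all rational. -}

module Defs where

open import Data.Nat using (ℕ; zero; suc)
open import Data.Fin using (Fin; zero; suc)
open import Data.Fin.Subset using (Subset; _∈_; _∉_)
open import Data.Vec using ([]; _∷_; updateAt)
open import Data.Bool using (true; false)
open import Data.Rational using (ℚ; 0ℚ; _+_; _≤_; _<_; _÷_; Positive; NonNegative)
open import Data.Rational.Properties using (pos⇒nonZero)
open import Data.Product using (Σ; _×_; ∃)
open import Relation.Nullary using (¬_)
open import Relation.Binary.PropositionalEquality using (_≡_; _≢_)

sumOver : ∀ {n} → Subset n → (Fin n → ℚ) → ℚ
sumOver []          f = 0ℚ
sumOver (true  ∷ s) f = f zero + sumOver s (λ j → f (suc j))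
sumOver (false ∷ s) f = sumOver s (λ j → f (suc j))

sumFin : ∀ {m} → (Fin m → ℚ) → ℚ
sumFin {zero}  f = 0ℚ
sumFin {suc m} f = f zero + sumFin (λ i → f (suc i))

-- An MDSP instance with n deliveries (numbered by Fin n) and battery budget B.
-- (The number m of drones is a separate parameter.)
record Instance (n : ℕ) : Set where
  field
    B     : ℚ
    B-pos : 0ℚ < B
    tL    : Fin n → ℚ
    tR    : Fin n → ℚ
    tL≤tR : ∀ j → tL j ≤ tR j
    c     : Fin n → ℚ
    c-pos : ∀ j → Positive (c j)
    p     : Fin n → ℚ
    p-nonneg : ∀ j → NonNegative (p j)

  d : Fin n → ℚ
  d j = _÷_ (p j) (c j) {{pos⇒nonZero (c j) {{c-pos j}}}}

  _∈I_ : ℚ → Fin n → Set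
  t ∈I j = (tL j ≤ t) × (t ≤ tR j)

  Compatible₂ : Fin n → Fin n → Set
  Compatible₂ j k = ¬ (∃ λ t → (t ∈I j) × (t ∈I k))

  CompatibleSet : Subset n → Set
  CompatibleSet S = ∀ j k → j ∈ S → k ∈ S → j ≢ k → Compatible₂ j k

  W : Subset n → ℚ
  W S = sumOver S c

  P : Subset n → ℚ
  P S = sumOver S p

  FeasibleSet : Subset n → Set
  FeasibleSet S = CompatibleSet S × (W S ≤ B)

  remove : Subset n → Fin n → Subset n
  remove S k = updateAt S k (λ _ → false)

  -- Critical: W(S) > B, and removing the last element k_l of a listing of S
  -- in non-increasing density order (i.e. some minimum-density element k of S)
  -- gives weight ≤ B.
  Critical : Subset n → Set
  Critical S = (B < W S) ×
    (∃ λ k → (k ∈ S) × (∀ j → j ∈ S → d k ≤ d j) × (W (remove S k) ≤ B))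

  PairwiseDisjoint : ∀ {m} → (Fin m → Subset n) → Set
  PairwiseDisjoint {m} T = ∀ (i i' : Fin m) (j : Fin n) → j ∈ T i → j ∈ T i' → i ≡ i'

  TotalProfit : ∀ {m} → (Fin m → Subset n) → ℚ
  TotalProfit T = sumFin (λ i → P (T i))

  -- f(m) ≤ x, unfolded: every pairwise disjoint family of m feasible sets
  -- has total profit ≤ x  (f(m) is the maximum of these finitely many values).
  fBoundedBy : ℕ → ℚ → Set
  fBoundedBy m x = ∀ (T : Fin m → Subset n) → PairwiseDisjoint T →
    (∀ i → FeasibleSet (T i)) → TotalProfit T ≤ x

{-# OPTIONS --safe #-}

-- Let δ ≥ 0 be the largest density outside U = ⋃ Sᵢ (0 if there is none). Every
-- delivery in U has reduced profit p − δc ≥ 0 and every other one has p − δc ≤ 0,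
-- so U maximises the total reduced profit over all sets of deliveries. If
-- T₁, …, Tₘ are disjoint and feasible with union X, then W(X) ≤ mB < W(U) since
-- each Sᵢ overflows the battery, hence P(X) ≤ P(U) − δ (W(U) − W(X)) ≤ P(U).

module Submission where

open import Defs
open import Data.Nat using (ℕ; zero; suc)
open import Data.Fin using (Fin; zero; suc)
open import Data.Fin.Properties using (suc-injective)
open import Data.Fin.Subset using (Subset; _∈_; _∉_; _∪_; ⋃; ⊥)
open import Data.Fin.Subset.Properties using (_∈?_; drop-there; ∉⊥; x∈p∪q⁺; x∈p∪q⁻)
open import Data.Rational using (ℚ; 0ℚ; _+_; -_; _-_; _*_; _≤_; 1ℚ; 1/_; NonZero; Positive; NonNegative; nonNegative)
import Data.Rational.Properties as Q
open import Data.Rational.Solver using (module +-*-Solver)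
open import Data.List as List using (List; allFin)
import Data.List.Extrema
open import Data.List.Membership.Propositional.Properties using (∈-allFin; ∈-filter⁺; ∈-map⁺)
import Data.List.Relation.Unary.All as All
open import Data.List.Relation.Unary.All.Properties using (all-filter; map⁺)
open import Data.Vec using (_∷_; []; here; there)
open import Data.Bool using (true; false)
open import Data.Product using (∃; _,_; proj₁; proj₂)
import Data.Product as Product
open import Data.Sum using (inj₁; inj₂; [_,_])
open import Data.Empty using (⊥-elim)
open import Function using (_∘_; id)
open import Relation.Binary using (DecTotalOrder)
open import Algebra using (CommutativeMonoid)
open import Relation.Nullary using (Dec; ¬?)
open import Relation.Binary.PropositionalEquality using (_≡_; refl; sym; trans; cong; subst; subst₂; module ≡-Reasoning)

open +-*-Solver using (solve; _:=_; _:+_; _:-_; _:*_)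
open import Algebra.Properties.CommutativeSemigroup (CommutativeMonoid.commutativeSemigroup Q.+-0-commutativeMonoid) using (x∙yz≈y∙xz)
open Data.List.Extrema (DecTotalOrder.totalOrder Q.≤-decTotalOrder) using (max; ⊥≤max; xs≤max; max≤v⁺)

private
  variable
    n m : ℕ

p≤q⇒0≤q-p : ∀ {p q} → p ≤ q → 0ℚ ≤ q - p
p≤q⇒0≤q-p {p} {q} p≤q = subst (_≤ q - p) (Q.+-inverseʳ p) (Q.+-monoˡ-≤ (- p) p≤q)

p≤q⇒p-q≤0 : ∀ {p q} → p ≤ q → p - q ≤ 0ℚ
p≤q⇒p-q≤0 {p} {q} p≤q = subst (p - q ≤_) (Q.+-inverseʳ q) (Q.+-monoˡ-≤ (- q) p≤q)

sumFin-mono : {f g : Fin m → ℚ} → (∀ i → f i ≤ g i) → sumFin f ≤ sumFin g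
sumFin-mono {zero}  f≤g = Q.≤-refl
sumFin-mono {suc m} f≤g = Q.+-mono-≤ (f≤g zero) (sumFin-mono (f≤g ∘ suc))

sumOver-⊥ : (f : Fin n → ℚ) → sumOver ⊥ f ≡ 0ℚ
sumOver-⊥ {zero}  f = refl
sumOver-⊥ {suc n} f = sumOver-⊥ (f ∘ suc)

disjoint-tail : ∀ {x y} {X Y : Subset n} → (∀ {j} → j ∈ x ∷ X → j ∉ y ∷ Y) → ∀ {j} → j ∈ X → j ∉ Y
disjoint-tail disj j∈X j∈Y = disj (there j∈X) (there j∈Y)

sumOver-∪ : (X Y : Subset n) (f : Fin n → ℚ) → (∀ {j} → j ∈ X → j ∉ Y) →
  sumOver (X ∪ Y) f ≡ sumOver X f + sumOver Y f
sumOver-∪ []          []          f disj = refl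
sumOver-∪ (true ∷ X)  (true ∷ Y)  f disj = ⊥-elim (disj here here)
sumOver-∪ (true ∷ X)  (false ∷ Y) f disj =
  trans (cong (f zero +_) (sumOver-∪ X Y (f ∘ suc) (disjoint-tail disj)))
        (sym (Q.+-assoc (f zero) (sumOver X (f ∘ suc)) (sumOver Y (f ∘ suc))))
sumOver-∪ (false ∷ X) (true ∷ Y)  f disj =
  trans (cong (f zero +_) (sumOver-∪ X Y (f ∘ suc) (disjoint-tail disj)))
        (x∙yz≈y∙xz (f zero) (sumOver X (f ∘ suc)) (sumOver Y (f ∘ suc)))
sumOver-∪ (false ∷ X) (false ∷ Y) f disj = sumOver-∪ X Y (f ∘ suc) (disjoint-tail disj)

⋃ᶠ : (Fin m → Subset n) → Subset n
⋃ᶠ T = ⋃ (List.tabulate T)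

∈⋃ᶠ⁺ : (T : Fin m → Subset n) (i : Fin m) {j : Fin n} → j ∈ T i → j ∈ ⋃ᶠ T
∈⋃ᶠ⁺ T zero    j∈Tᵢ = x∈p∪q⁺ (inj₁ j∈Tᵢ)
∈⋃ᶠ⁺ T (suc i) j∈Tᵢ = x∈p∪q⁺ (inj₂ (∈⋃ᶠ⁺ (T ∘ suc) i j∈Tᵢ))

∈⋃ᶠ⁻ : (T : Fin m → Subset n) {j : Fin n} → j ∈ ⋃ᶠ T → ∃ λ i → j ∈ T i
∈⋃ᶠ⁻ {zero}  T j∈⋃T = ⊥-elim (∉⊥ j∈⋃T)
∈⋃ᶠ⁻ {suc m} T j∈⋃T =
  [ (λ j∈T₀ → zero , j∈T₀) , Product.map suc id ∘ ∈⋃ᶠ⁻ (T ∘ suc) ] (x∈p∪q⁻ (T zero) _ j∈⋃T)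

sumFin-sumOver-⋃ᶠ : (T : Fin m → Subset n) (f : Fin n → ℚ) →
  (∀ i i' j → j ∈ T i → j ∈ T i' → i ≡ i') →
  sumFin (λ i → sumOver (T i) f) ≡ sumOver (⋃ᶠ T) f
sumFin-sumOver-⋃ᶠ {zero}  T f disj = sym (sumOver-⊥ f)
sumFin-sumOver-⋃ᶠ {suc m} T f disj = begin
  sumOver (T zero) f + sumFin (λ i → sumOver (T (suc i)) f)  ≡⟨ cong (sumOver (T zero) f +_) (sumFin-sumOver-⋃ᶠ (T ∘ suc) f disj-tail) ⟩
  sumOver (T zero) f + sumOver (⋃ᶠ (T ∘ suc)) f              ≡⟨ sym (sumOver-∪ (T zero) (⋃ᶠ (T ∘ suc)) f T₀∩rest≡∅) ⟩
  sumOver (⋃ᶠ T) f                                           ∎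
  where
  open ≡-Reasoning
  disj-tail : ∀ i i' j → j ∈ T (suc i) → j ∈ T (suc i') → i ≡ i'
  disj-tail i i' j j∈Tᵢ j∈Tᵢ' = suc-injective (disj (suc i) (suc i') j j∈Tᵢ j∈Tᵢ')
  T₀∩rest≡∅ : ∀ {j} → j ∈ T zero → j ∉ ⋃ᶠ (T ∘ suc)
  T₀∩rest≡∅ {j} j∈T₀ j∈rest with ∈⋃ᶠ⁻ (T ∘ suc) j∈rest
  ... | i , j∈Tᵢ with () ← disj zero (suc i) j j∈T₀ j∈Tᵢ

sumOver-maximal-on-nonNeg-part : (e : Fin n → ℚ) (Y : Subset n) →
  (∀ {j} → j ∈ Y → 0ℚ ≤ e j) → (∀ {j} → j ∉ Y → e j ≤ 0ℚ) →
  ∀ X → sumOver X e ≤ sumOver Y e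
sumOver-maximal-on-nonNeg-part e []      e≥0 e≤0 [] = Q.≤-refl
sumOver-maximal-on-nonNeg-part e (y ∷ Y) e≥0 e≤0 (x ∷ X)
  with sumOver-maximal-on-nonNeg-part (e ∘ suc) Y (e≥0 ∘ there) (e≤0 ∘ (_∘ drop-there)) X
sumOver-maximal-on-nonNeg-part e (true ∷ Y)  e≥0 e≤0 (true ∷ X)  | ih = Q.+-monoʳ-≤ (e zero) ih
sumOver-maximal-on-nonNeg-part e (false ∷ Y) e≥0 e≤0 (false ∷ X) | ih = ih
sumOver-maximal-on-nonNeg-part e (false ∷ Y) e≥0 e≤0 (true ∷ X)  | ih = begin
  e zero + sumOver X (e ∘ suc)  ≤⟨ Q.+-monoˡ-≤ (sumOver X (e ∘ suc)) (e≤0 λ ()) ⟩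
  0ℚ + sumOver X (e ∘ suc)      ≡⟨ Q.+-identityˡ (sumOver X (e ∘ suc)) ⟩
  sumOver X (e ∘ suc)           ≤⟨ ih ⟩
  sumOver Y (e ∘ suc)           ∎
  where open Q.≤-Reasoning
sumOver-maximal-on-nonNeg-part e (true ∷ Y)  e≥0 e≤0 (false ∷ X) | ih = begin
  sumOver X (e ∘ suc)           ≤⟨ ih ⟩
  sumOver Y (e ∘ suc)           ≡⟨ Q.+-identityˡ (sumOver Y (e ∘ suc)) ⟨
  0ℚ + sumOver Y (e ∘ suc)      ≤⟨ Q.+-monoˡ-≤ (sumOver Y (e ∘ suc)) (e≥0 here) ⟩
  e zero + sumOver Y (e ∘ suc)  ∎
  where open Q.≤-Reasoning

sumOver-linear : (X : Subset n) (f g : Fin n → ℚ) (k : ℚ) →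
  sumOver X (λ j → f j - k * g j) ≡ sumOver X f - k * sumOver X g
sumOver-linear []          f g k = sym (cong (λ x → 0ℚ - x) (Q.*-zeroʳ k))
sumOver-linear (true ∷ X)  f g k = begin
  f zero - k * g zero + sumOver X (λ j → f (suc j) - k * g (suc j))
    ≡⟨ cong (f zero - k * g zero +_) (sumOver-linear X (f ∘ suc) (g ∘ suc) k) ⟩
  f zero - k * g zero + (sumOver X (f ∘ suc) - k * sumOver X (g ∘ suc))
    ≡⟨ solve 5 (λ a b K A B → a :- K :* b :+ (A :- K :* B) := a :+ A :- K :* (b :+ B)) refl
         (f zero) (g zero) k (sumOver X (f ∘ suc)) (sumOver X (g ∘ suc)) ⟩
  f zero + sumOver X (f ∘ suc) - k * (g zero + sumOver X (g ∘ suc))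
    ∎
  where open ≡-Reasoning
sumOver-linear (false ∷ X) f g k = sumOver-linear X (f ∘ suc) (g ∘ suc) k

sumOver-≤-by-threshold : (p c : Fin n → ℚ) (δ : ℚ) (X Y : Subset n) → 0ℚ ≤ δ →
  (∀ {j} → j ∈ Y → δ * c j ≤ p j) → (∀ {j} → j ∉ Y → p j ≤ δ * c j) →
  sumOver X c ≤ sumOver Y c → sumOver X p ≤ sumOver Y p
sumOver-≤-by-threshold p c δ X Y δ≥0 above below cX≤cY = begin
  pX                      ≡⟨ solve 3 (λ a b x → a := a :- b :* x :+ b :* x) refl pX δ cX ⟩
  pX - δ * cX + δ * cX    ≤⟨ Q.+-monoˡ-≤ (δ * cX) reduced ⟩
  pY - δ * cY + δ * cX    ≤⟨ Q.+-monoʳ-≤ (pY - δ * cY) (Q.*-monoˡ-≤-nonNeg δ {{nonNegative δ≥0}} cX≤cY) ⟩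
  pY - δ * cY + δ * cY    ≡⟨ solve 3 (λ a b y → a :- b :* y :+ b :* y := a) refl pY δ cY ⟩
  pY                      ∎
  where
  open Q.≤-Reasoning
  pX pY cX cY : ℚ
  pX = sumOver X p
  pY = sumOver Y p
  cX = sumOver X c
  cY = sumOver Y c
  reduced : pX - δ * cX ≤ pY - δ * cY
  reduced = subst₂ _≤_ (sumOver-linear X p c δ) (sumOver-linear Y p c δ)
    (sumOver-maximal-on-nonNeg-part (λ j → p j - δ * c j) Y (p≤q⇒0≤q-p ∘ above) (p≤q⇒p-q≤0 ∘ below) X)

_∉?_ : (v : Fin n) (U : Subset n) → Dec (v ∉ U)
v ∉? U = ¬? (v ∈? U)

valuesOutside : (Fin n → ℚ) → Subset n → List ℚ
valuesOutside f U = List.map f (List.filter (_∉? U) (allFin _))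

maxOutside : (Fin n → ℚ) → Subset n → ℚ
maxOutside f U = max 0ℚ (valuesOutside f U)

maxOutside-nonNeg : (f : Fin n → ℚ) (U : Subset n) → 0ℚ ≤ maxOutside f U
maxOutside-nonNeg f U = ⊥≤max 0ℚ (valuesOutside f U)

≤maxOutside : (f : Fin n → ℚ) (U : Subset n) {v : Fin n} → v ∉ U → f v ≤ maxOutside f U
≤maxOutside f U {v} v∉U =
  All.lookup (xs≤max 0ℚ (valuesOutside f U)) (∈-map⁺ f (∈-filter⁺ (_∉? U) (∈-allFin v) v∉U))

maxOutside-least : (f : Fin n → ℚ) (U : Subset n) {x : ℚ} →
  (∀ {v} → v ∉ U → f v ≤ x) → 0ℚ ≤ x → maxOutside f U ≤ x
maxOutside-least f U f≤x 0≤x = max≤v⁺ 0≤x (map⁺ (All.map f≤x (all-filter (_∉? U) (allFin _))))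

module _ {n} (I : Instance n) where
  open Instance I

  private instance
    c>0 : ∀ {j} → Positive (c j)
    c>0 {j} = c-pos j
    c≥0 : ∀ {j} → NonNegative (c j)
    c≥0 {j} = Q.pos⇒nonNeg (c j)
    c≢0 : ∀ {j} → NonZero (c j)
    c≢0 {j} = Q.pos⇒nonZero (c j)
    p≥0 : ∀ {j} → NonNegative (p j)
    p≥0 {j} = p-nonneg j

  density-nonNeg : ∀ j → 0ℚ ≤ d j
  density-nonNeg j = Q.nonNegative⁻¹ (d j)
    {{Q.nonNeg*nonNeg⇒nonNeg (p j) (1/ c j) {{Q.pos⇒nonNeg (1/ c j) {{Q.1/pos⇒pos (c j)}}}}}}

  density*cost≡profit : ∀ j → d j * c j ≡ p j
  density*cost≡profit j = begin
    p j * 1/ c j * c j    ≡⟨ Q.*-assoc (p j) (1/ c j) (c j) ⟩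
    p j * (1/ c j * c j)  ≡⟨ cong (p j *_) (Q.*-inverseˡ (c j)) ⟩
    p j * 1ℚ              ≡⟨ Q.*-identityʳ (p j) ⟩
    p j                   ∎
    where open ≡-Reasoning

  ≤density⇒*cost≤profit : ∀ {x} j → x ≤ d j → x * c j ≤ p j
  ≤density⇒*cost≤profit {x} j x≤d = subst (x * c j ≤_) (density*cost≡profit j) (Q.*-monoʳ-≤-nonNeg (c j) x≤d)

  density≤⇒profit≤*cost : ∀ {x} j → d j ≤ x → p j ≤ x * c j
  density≤⇒profit≤*cost {x} j d≤x = subst (_≤ x * c j) (density*cost≡profit j) (Q.*-monoʳ-≤-nonNeg (c j) d≤x)

lemma2 : ∀ {n} (I : Instance n) (m : ℕ) (S : Fin m → Subset n) →
    let open Instance I in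
    PairwiseDisjoint S →
    (∀ i → CompatibleSet (S i)) →
    (∀ i → Critical (S i)) →
    (∀ u v → (∃ λ i → u ∈ S i) → (∀ i → v ∉ S i) → d v ≤ d u) →
    fBoundedBy m (TotalProfit S)
lemma2 {n} I m S disjS _ critS dens T disjT feasT = begin
  TotalProfit T  ≡⟨ sumFin-sumOver-⋃ᶠ T p disjT ⟩
  P (⋃ᶠ T)       ≤⟨ sumOver-≤-by-threshold p c δ (⋃ᶠ T) U (maxOutside-nonNeg d U) above below weight ⟩
  P U            ≡⟨ sumFin-sumOver-⋃ᶠ S p disjS ⟨
  TotalProfit S  ∎
  where
  open Instance I
  open Q.≤-Reasoning
  U : Subset n
  U = ⋃ᶠ S
  δ : ℚ
  δ = maxOutside d U
  above : ∀ {u} → u ∈ U → δ * c u ≤ p u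
  above {u} u∈U = ≤density⇒*cost≤profit I u (maxOutside-least d U d≤dᵤ (density-nonNeg I u))
    where
    d≤dᵤ : ∀ {v} → v ∉ U → d v ≤ d u
    d≤dᵤ {v} v∉U = dens u v (∈⋃ᶠ⁻ S u∈U) (λ i v∈Sᵢ → v∉U (∈⋃ᶠ⁺ S i v∈Sᵢ))
  below : ∀ {v} → v ∉ U → p v ≤ δ * c v
  below {v} v∉U = density≤⇒profit≤*cost I v (≤maxOutside d U v∉U)
  weight : W (⋃ᶠ T) ≤ W U
  weight = subst₂ _≤_ (sumFin-sumOver-⋃ᶠ T c disjT) (sumFin-sumOver-⋃ᶠ S c disjS)
    (sumFin-mono λ i → Q.≤-trans (proj₂ (feasT i)) (Q.<⇒≤ (proj₁ (critS i))))
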